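{- Let $h\ge 0$ be an integer and let $H$ be a pseudo-buoy with bags $B_1,\ldots,B_5$ such that, for each $i \bmod 5$, $H[B_i]$ is $k_i$-colorable, where $k_1,\ldots,k_5$ are integers satisfying $k_i+k_{i+1}\le h$ for each $i\bmod 5$. Then: (i) if $\sum_{i=1}^5 k_i\le 2h$, then $\chi(H)\le h$; (ii) if $\sum_{i=1}^5 k_i>2h$ and each $H[B_i]$ has chromatic number exactly $k_i$, then $\chi(H)>h$.
   Context: All graphs are finite and simple. A pseudo-buoy is a graph whose vertex set is partitioned into five (possibly empty) sets $B_1,\ldots,B_5$ (the bags) such that for $i\ne j$, every vertex of $B_i$ is adjacent to every vertex of $B_j$ if $j=i\pm 1 \bmod 5$, and no vertex of $B_i$ is adjacent to any vertex of $B_j$ otherwise; edges inside each bag are arbitrary. An empty graph is considered $0$-colorable. -}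

module Defs where

open import Data.Nat using (ℕ; _+_; _<_)
open import Data.Fin using (Fin; zero; suc)
open import Data.Product using (Σ; _×_; ∃)
open import Relation.Nullary using (¬_)
open import Relation.Binary.PropositionalEquality using (_≡_; _≢_)
open import Data.Sum using (_⊎_)
open import Level using (0ℓ)

record Graph : Set₁ where
  field
    n     : ℕ
    Adj   : Fin n → Fin n → Set
    sym   : ∀ {u v} → Adj u v → Adj v u
    irrefl : ∀ {u} → ¬ Adj u u
open Graph public

-- Successor modulo 5 on the bag indices (Fin 5 represents indices 1..5).
next5 : Fin 5 → Fin 5
next5 zero = suc zero
next5 (suc zero) = suc (suc zero)
next5 (suc (suc zero)) = suc (suc (suc zero))
next5 (suc (suc (suc zero))) = suc (suc (suc (suc zero)))
next5 (suc (suc (suc (suc zero)))) = zero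

-- A bag assignment b : V → Fin 5 witnesses that G is a pseudo-buoy with
-- bags B_i = b⁻¹(i): vertices in different bags are adjacent iff their
-- bags are cyclically consecutive; edges inside a bag are arbitrary.
IsPseudoBuoy : (G : Graph) → (Fin (n G) → Fin 5) → Set
IsPseudoBuoy G b = ∀ u v → b u ≢ b v →
  (Adj G u v → (b v ≡ next5 (b u) ⊎ b u ≡ next5 (b v))) ×
  ((b v ≡ next5 (b u) ⊎ b u ≡ next5 (b v)) → Adj G u v)

Colorable : Graph → ℕ → Set
Colorable G k = Σ (Fin (n G) → Fin k) λ c → ∀ u v → Adj G u v → c u ≢ c v

InducedColorable : (G : Graph) → (Fin (n G) → Set) → ℕ → Set
InducedColorable G S k =
  Σ ((v : Fin (n G)) → S v → Fin k) λ c →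
    ∀ u v (su : S u) (sv : S v) → Adj G u v → c u su ≢ c v sv

InducedChromaticNumber : (G : Graph) → (Fin (n G) → Set) → ℕ → Set
InducedChromaticNumber G S k =
  InducedColorable G S k × (∀ m → m < k → ¬ InducedColorable G S m)

Bag : (G : Graph) → (Fin (n G) → Fin 5) → Fin 5 → Fin (n G) → Set
Bag G b i v = b v ≡ i

sum5 : (Fin 5 → ℕ) → ℕ
sum5 k = k zero + k (suc zero) + k (suc (suc zero)) + k (suc (suc (suc zero)))
       + k (suc (suc (suc (suc zero))))

module Submission where

open import Defs
open import Data.Nat using (ℕ; _+_; _*_; _≤_; _>_)
open import Data.Fin using (Fin)
open import Data.Product using (_×_)
open import Relation.Nullary using (¬_)

open import Data.Nat using (suc; _∸_; _<_; z≤n; NonZero; >-nonZero)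
open import Data.Nat.Properties
open import Data.Nat.DivMod using (_%_; _/_; _mod_; m%n<n; m≡m%n+[m/n]*n; [m+kn]%n≡m%n)
open import Data.Nat.Tactic.RingSolver using (solve-∀)
open import Data.Fin using (zero; suc; toℕ)
open import Data.Fin.Properties using (any?; toℕ<n; toℕ-fromℕ<; toℕ-injective)
  renaming (_≟_ to _≟ᶠ_)
open import Data.List using (List; _∷_; []; length; filter; allFin)
open import Data.List.Properties using (length-tabulate)
open import Data.List.Relation.Unary.Any using (index)
open import Data.List.Membership.Propositional using (_∈_)
open import Data.List.Membership.Propositional.Properties using (∈-filter⁺; ∈-allFin)
open import Data.List.Membership.Setoid.Properties using (index-injective)
open import Data.Product using (Σ; ∃; _,_; proj₁; proj₂)
open import Data.Sum using (inj₁; inj₂)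
open import Data.Empty using (⊥-elim)
open import Function using (id)
open import Relation.Nullary using (Dec; yes; no)
open import Relation.Nullary.Decidable using (_×-dec_)
open import Relation.Unary using (Decidable)
open import Relation.Binary using (tri<; tri≈; tri>)
open import Relation.Binary.PropositionalEquality as ≡ using (_≡_; _≢_; refl; cong; subst₂)

-- Proof idea.  Bags are indexed by Fin 5; write S = k₀ + … + k₄.
--
-- (i) Think of the h colours as points on a circle of circumference h and walk twice
-- around it, bag after bag: bag i receives the arc of k i consecutive colours starting at
-- position start i (read modulo h), and the gap from start i to start (i+1) is at least
-- k i and at most h − k (i+1), the five gaps adding up to exactly 2h.  Then every bag
-- gets k i distinct colours and consecutive bags get disjoint arcs, so colouring each bag
-- through its palette properly colours the pseudo-buoy.  Such gaps exist because S ≤ 2h: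
-- start from the gaps k i and put the missing 2h − S into the slack h − k₀ − k₁ after
-- bag 0 and the slack h − k₂ − k₃ after bag 2.
--
-- (ii) In an h-colouring, bag i uses at least χ(H[B_i]) = k i colours, and no colour
-- appears on two consecutive bags, hence on at most two bags (the 5-cycle has
-- independence number 2).  Double counting the pairs (bag, colour used on it) gives
-- S ≤ 2h, contradicting S > 2h.

sum5-mono : ∀ {f g : Fin 5 → ℕ} → (∀ i → f i ≤ g i) → sum5 f ≤ sum5 g
sum5-mono f≤g = +-mono-≤ (+-mono-≤ (+-mono-≤ (+-mono-≤ (f≤g _) (f≤g _)) (f≤g _)) (f≤g _)) (f≤g _)

sum5-+ : ∀ (f g : Fin 5 → ℕ) → sum5 (λ i → f i + g i) ≡ sum5 f + sum5 g
sum5-+ f g = regroup (f zero) (f (suc zero)) (f (suc (suc zero))) (f (suc (suc (suc zero))))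
                     (f (suc (suc (suc (suc zero)))))
                     (g zero) (g (suc zero)) (g (suc (suc zero))) (g (suc (suc (suc zero))))
                     (g (suc (suc (suc (suc zero)))))
  where
  regroup : ∀ a₀ a₁ a₂ a₃ a₄ b₀ b₁ b₂ b₃ b₄ →
    (a₀ + b₀) + (a₁ + b₁) + (a₂ + b₂) + (a₃ + b₃) + (a₄ + b₄)
      ≡ (a₀ + a₁ + a₂ + a₃ + a₄) + (b₀ + b₁ + b₂ + b₃ + b₄)
  regroup = solve-∀

sum5-cyclic : ∀ (f : Fin 5 → ℕ) → sum5 (λ i → f i + f (next5 i)) ≡ 2 * sum5 f
sum5-cyclic f = twice (f zero) (f (suc zero)) (f (suc (suc zero))) (f (suc (suc (suc zero))))
                      (f (suc (suc (suc (suc zero)))))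
  where
  twice : ∀ a₀ a₁ a₂ a₃ a₄ →
    (a₀ + a₁) + (a₁ + a₂) + (a₂ + a₃) + (a₃ + a₄) + (a₄ + a₀) ≡ 2 * (a₀ + a₁ + a₂ + a₃ + a₄)
  twice = solve-∀

cycle-independence : ∀ (f : Fin 5 → ℕ) → (∀ i → f i + f (next5 i) ≤ 1) → sum5 f ≤ 2
cycle-independence f pairs = ≤-pred (*-cancelˡ-< 2 (sum5 f) 3 (begin-strict
    2 * sum5 f                        ≡⟨ sum5-cyclic f ⟨
    sum5 (λ i → f i + f (next5 i))    ≤⟨ sum5-mono pairs ⟩
    5                                 <⟨ ≤-refl ⟩
    6                                 ∎))
  where open ≤-Reasoning

split-budget : ∀ {r a b} → r ≤ a + b → Σ ℕ λ x → Σ ℕ λ y → x ≤ a × y ≤ b × x + y ≡ r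
split-budget {r} {a} r≤a+b with r ≤? a
... | yes r≤a = r , 0 , r≤a , z≤n , +-identityʳ r
... | no r≰a  = a , r ∸ a , ≤-refl , m≤n+o⇒m∸n≤o r a r≤a+b , m+[n∸m]≡n (<⇒≤ (≰⇒> r≰a))

∸-distrib-+ : ∀ {m m′ a c} → a ≤ m → c ≤ m′ → (m + m′) ∸ (a + c) ≡ (m ∸ a) + (m′ ∸ c)
∸-distrib-+ {m} {m′} {a} {c} a≤m c≤m′ = begin
  (m + m′) ∸ (a + c)   ≡⟨ ∸-+-assoc (m + m′) a c ⟨
  (m + m′) ∸ a ∸ c     ≡⟨ cong (_∸ c) (+-∸-comm m′ a≤m) ⟩
  (m ∸ a + m′) ∸ c     ≡⟨ +-∸-assoc (m ∸ a) c≤m′ ⟩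
  (m ∸ a) + (m′ ∸ c)   ∎
  where open ≡.≡-Reasoning

%-distinct : ∀ h .{{_ : NonZero h}} {x y} → x < y → y < x + h → x % h ≢ y % h
%-distinct h {x} {y} x<y y<x+h same = <⇒≱ y<x+h x+h≤y
  where
  open ≤-Reasoning
  r : ℕ
  r = x % h
  x≡ : x ≡ r + x / h * h
  x≡ = m≡m%n+[m/n]*n x h
  y≡ : y ≡ r + y / h * h
  y≡ = ≡.trans (m≡m%n+[m/n]*n y h) (cong (_+ y / h * h) (≡.sym same))
  quotients : x / h < y / h
  quotients = *-cancelʳ-< h (x / h) (y / h) (+-cancelˡ-< r _ _ (subst₂ _<_ x≡ y≡ x<y))
  x+h≤y : x + h ≤ y
  x+h≤y = begin
    x + h                 ≡⟨ cong (_+ h) x≡ ⟩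
    r + x / h * h + h     ≡⟨ +-assoc r _ h ⟩
    r + (x / h * h + h)   ≡⟨ cong (r +_) (+-comm _ h) ⟩
    r + suc (x / h) * h   ≤⟨ +-monoʳ-≤ r (*-monoˡ-≤ h quotients) ⟩
    r + y / h * h         ≡⟨ y≡ ⟨
    y                     ∎

%-window-distinct : ∀ h .{{_ : NonZero h}} s {x y} → x < y → y < h → (s + x) % h ≢ (s + y) % h
%-window-distinct h s {x} {y} x<y y<h = %-distinct h (+-monoʳ-< s x<y) s+y<s+x+h
  where
  s+y<s+x+h : s + y < s + x + h
  s+y<s+x+h = subst₂ _<_ refl (≡.sym (+-assoc s x h)) (+-monoʳ-< s (<-≤-trans y<h (m≤n+m h x)))

%-injective-on-window : ∀ h .{{_ : NonZero h}} s {x y} → x < h → y < h →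
  (s + x) % h ≡ (s + y) % h → x ≡ y
%-injective-on-window h s {x} {y} x<h y<h same with <-cmp x y
... | tri< x<y _ _ = ⊥-elim (%-window-distinct h s x<y y<h same)
... | tri≈ _ x≡y _ = x≡y
... | tri> _ _ y<x = ⊥-elim (%-window-distinct h s y<x x<h (≡.sym same))

%-arcs-disjoint : ∀ h .{{_ : NonZero h}} s {a g b c d} → c < a → a ≤ g → d < b → g + b ≤ h →
  (s + c) % h ≢ (s + g + d) % h
%-arcs-disjoint h s {a} {g} {b} {c} {d} c<a a≤g d<b g+b≤h =
  %-distinct h (subst₂ _<_ refl (≡.sym (+-assoc s g d)) (+-monoʳ-< s c<g+d))
               (subst₂ _<_ (≡.sym (+-assoc s g d)) (≡.sym (+-assoc s c h)) (+-monoʳ-< s g+d<c+h))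
  where
  c<g+d : c < g + d
  c<g+d = <-≤-trans c<a (≤-trans a≤g (m≤m+n g d))
  g+d<c+h : g + d < c + h
  g+d<c+h = <-≤-trans (+-monoʳ-< g d<b) (≤-trans g+b≤h (m≤n+m h c))

mod⇒% : ∀ {h} .{{_ : NonZero h}} {x y} → x mod h ≡ y mod h → x % h ≡ y % h
mod⇒% {h} {x} {y} same =
  ≡.trans (≡.sym (toℕ-fromℕ< (m%n<n x h))) (≡.trans (cong toℕ same) (toℕ-fromℕ< (m%n<n y h)))

record Palettes (h : ℕ) (k : Fin 5 → ℕ) : Set where
  field
    palette   : ∀ i → Fin (k i) → Fin h
    injective : ∀ i {c d} → palette i c ≡ palette i d → c ≡ d
    disjoint  : ∀ i c d → palette i c ≢ palette (next5 i) d

colourable-from-palettes : (H : Graph) (b : Fin (n H) → Fin 5) → IsPseudoBuoy H b →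
  (k : Fin 5 → ℕ) → (∀ i → InducedColorable H (Bag H b i) (k i)) →
  ∀ {h} → Palettes h k → Colorable H h
colourable-from-palettes H b buoy k bagColouring {h} P = colour , proper
  where
  open Palettes P
  colourIn : ∀ v i → b v ≡ i → Fin h
  colourIn v i v∈i = palette i (proj₁ (bagColouring i) v v∈i)
  colour : Fin (n H) → Fin h
  colour v = colourIn v (b v) refl
  colour-via : ∀ v i (v∈i : b v ≡ i) → colour v ≡ colourIn v i v∈i
  colour-via v _ refl = refl
  proper : ∀ u v → Adj H u v → colour u ≢ colour v
  proper u v uv same with b u ≟ᶠ b v
  ... | yes bu≡bv = proj₂ (bagColouring (b v)) u v bu≡bv refl uv
                      (injective (b v) (≡.trans (≡.sym (colour-via u _ bu≡bv)) same))
  ... | no bu≢bv with proj₁ (buoy u v bu≢bv) uv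
  ...   | inj₁ v∈next = disjoint (b u) _ _ (≡.trans same (colour-via v _ v∈next))
  ...   | inj₂ u∈next = disjoint (b v) _ _ (≡.trans (≡.sym same) (colour-via u _ u∈next))

-- A circular arrangement of the bags: walking around the 5-cycle, bag i is followed by a
-- gap of length gap i, long enough for its own k i colours and short enough that the next
-- bag's k (i+1) colours end before the arc of bag i comes round again; in total the walk
-- winds twice around the circle of h colours.
record Gaps (h : ℕ) (k : Fin 5 → ℕ) : Set where
  field
    gap   : Fin 5 → ℕ
    room  : ∀ i → k i ≤ gap i
    clear : ∀ i → gap i + k (next5 i) ≤ h
    total : sum5 gap ≡ 2 * h

palettes-from-gaps : ∀ {h k} → Gaps h k → Palettes h k
palettes-from-gaps {h} {k} G = record
  { palette   = palette
  ; injective = λ i {c} {d} same →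
      toℕ-injective (%-injective-on-window h {{positive c}} (start i) (bound c) (bound d)
                                            (mod⇒% {{positive c}} same))
  ; disjoint  = λ i c d same →
      %-arcs-disjoint h {{positive c}} (start i) (toℕ<n c) (room i) (toℕ<n d) (clear i)
        (≡.trans (mod⇒% {{positive c}} same) (≡.sym (wrap i (toℕ d) {{positive c}})))
  }
  where
  open Gaps G
  start : Fin 5 → ℕ
  start zero                         = 0
  start (suc zero)                   = gap zero
  start (suc (suc zero))             = gap zero + gap (suc zero)
  start (suc (suc (suc zero)))       = gap zero + gap (suc zero) + gap (suc (suc zero))
  start (suc (suc (suc (suc zero)))) =
    gap zero + gap (suc zero) + gap (suc (suc zero)) + gap (suc (suc (suc zero)))
  k≤h : ∀ i → k i ≤ h
  k≤h i = ≤-trans (room i) (m+n≤o⇒m≤o (gap i) (clear i))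
  bound : ∀ {i} (c : Fin (k i)) → toℕ c < h
  bound {i} c = <-≤-trans (toℕ<n c) (k≤h i)
  -- a bag with a colour to give out forces h > 0
  positive : ∀ {i} → Fin (k i) → NonZero h
  positive c = >-nonZero (≤-<-trans z≤n (bound c))
  palette : ∀ i → Fin (k i) → Fin h
  palette i c = _mod_ (start i + toℕ c) h {{positive c}}
  wrap : ∀ i x .{{_ : NonZero h}} → (start i + gap i + x) % h ≡ (start (next5 i) + x) % h
  wrap zero                         x = refl
  wrap (suc zero)                   x = refl
  wrap (suc (suc zero))             x = refl
  wrap (suc (suc (suc zero)))       x = refl
  wrap (suc (suc (suc (suc zero)))) x = begin
    (sum5 gap + x) % h   ≡⟨ cong (λ t → (t + x) % h) total ⟩
    (2 * h + x) % h      ≡⟨ cong (_% h) (+-comm (2 * h) x) ⟩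
    (x + 2 * h) % h      ≡⟨ [m+kn]%n≡m%n x 2 h ⟩
    x % h                ∎
    where open ≡.≡-Reasoning

fits-slack : ∀ a b {x h} → a + b ≤ h → x ≤ h ∸ (a + b) → a + x + b ≤ h
fits-slack a b {x} {h} a+b≤h x≤slack = begin
  a + x + b     ≡⟨ cong (_+ b) (+-comm a x) ⟩
  x + a + b     ≡⟨ +-assoc x a b ⟩
  x + (a + b)   ≤⟨ m≤o∸n⇒m+n≤o x a+b≤h x≤slack ⟩
  h             ∎
  where open ≤-Reasoning

excess-fits : ∀ {h} a b c d e → a + b ≤ h → c + d ≤ h →
  2 * h ∸ (a + b + c + d + e) ≤ (h ∸ (a + b)) + (h ∸ (c + d))
excess-fits {h} a b c d e a+b≤h c+d≤h = begin
  2 * h ∸ (a + b + c + d + e)        ≤⟨ ∸-monoʳ-≤ (2 * h) four≤five ⟩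
  2 * h ∸ (a + b + (c + d))          ≡⟨ cong (λ t → h + t ∸ (a + b + (c + d))) (+-identityʳ h) ⟩
  h + h ∸ (a + b + (c + d))          ≡⟨ ∸-distrib-+ a+b≤h c+d≤h ⟩
  (h ∸ (a + b)) + (h ∸ (c + d))      ∎
  where
  open ≤-Reasoning
  four≤five : a + b + (c + d) ≤ a + b + c + d + e
  four≤five = ≤-trans (≤-reflexive (≡.sym (+-assoc (a + b) c d))) (m≤m+n _ e)

gaps-exist : ∀ h (k : Fin 5 → ℕ) → (∀ i → k i + k (next5 i) ≤ h) → sum5 k ≤ 2 * h → Gaps h k
gaps-exist h k pairs S≤2h =
  gaps (split-budget (excess-fits k₀ k₁ k₂ k₃ k₄ (pairs zero) (pairs (suc (suc zero)))))
  where
  k₀ k₁ k₂ k₃ k₄ : ℕ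
  k₀ = k zero
  k₁ = k (suc zero)
  k₂ = k (suc (suc zero))
  k₃ = k (suc (suc (suc zero)))
  k₄ = k (suc (suc (suc (suc zero))))
  regroup : ∀ a₀ a₁ a₂ a₃ a₄ u v →
    a₀ + u + a₁ + (a₂ + v) + a₃ + a₄ ≡ (a₀ + a₁ + a₂ + a₃ + a₄) + (u + v)
  regroup = solve-∀
  gaps : (Σ ℕ λ x → Σ ℕ λ y → x ≤ h ∸ (k₀ + k₁) × y ≤ h ∸ (k₂ + k₃) × x + y ≡ 2 * h ∸ sum5 k) →
         Gaps h k
  gaps (x , y , x≤slack₀₁ , y≤slack₂₃ , x+y≡excess) =
    record { gap = gap ; room = room ; clear = clear ; total = total }
    where
    gap : Fin 5 → ℕ
    gap zero                         = k₀ + x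
    gap (suc zero)                   = k₁
    gap (suc (suc zero))             = k₂ + y
    gap (suc (suc (suc zero)))       = k₃
    gap (suc (suc (suc (suc zero)))) = k₄
    room : ∀ i → k i ≤ gap i
    room zero                         = m≤m+n k₀ x
    room (suc zero)                   = ≤-refl
    room (suc (suc zero))             = m≤m+n k₂ y
    room (suc (suc (suc zero)))       = ≤-refl
    room (suc (suc (suc (suc zero)))) = ≤-refl
    clear : ∀ i → gap i + k (next5 i) ≤ h
    clear zero                         = fits-slack k₀ k₁ (pairs zero) x≤slack₀₁
    clear (suc zero)                   = pairs (suc zero)
    clear (suc (suc zero))             = fits-slack k₂ k₃ (pairs (suc (suc zero))) y≤slack₂₃
    clear (suc (suc (suc zero)))       = pairs (suc (suc (suc zero)))
    clear (suc (suc (suc (suc zero)))) = pairs (suc (suc (suc (suc zero))))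
    total : sum5 gap ≡ 2 * h
    total = begin
      sum5 gap                   ≡⟨ regroup k₀ k₁ k₂ k₃ k₄ x y ⟩
      sum5 k + (x + y)           ≡⟨ cong (sum5 k +_) x+y≡excess ⟩
      sum5 k + (2 * h ∸ sum5 k)  ≡⟨ m+[n∸m]≡n S≤2h ⟩
      2 * h                      ∎
      where open ≡.≡-Reasoning

chromatic-lower : ∀ (G : Graph) (S : Fin (n G) → Set) {k m} →
  InducedChromaticNumber G S k → InducedColorable G S m → k ≤ m
chromatic-lower G S (_ , minimal) colouring = ≮⇒≥ (λ m<k → minimal _ m<k colouring)

recolour-into : ∀ {h} (G : Graph) (S : Fin (n G) → Set) (xs : List (Fin h)) →
  (colouring : InducedColorable G S h) → (∀ v sv → proj₁ colouring v sv ∈ xs) →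
  InducedColorable G S (length xs)
recolour-into G S xs (_ , proper) inXs =
  (λ v sv → index (inXs v sv)) ,
  λ u v su sv uv same →
    proper u v su sv uv (index-injective (≡.setoid _) (inXs u su) (inXs v sv) same)

indicator : ∀ {P : Set} → Dec P → ℕ
indicator (yes _) = 1
indicator (no _)  = 0

length-filter-∷ : ∀ {A : Set} {P : A → Set} (P? : Decidable P) x xs →
  length (filter P? (x ∷ xs)) ≡ indicator (P? x) + length (filter P? xs)
length-filter-∷ P? x xs with P? x
... | yes _ = refl
... | no _  = refl

double-count : ∀ {A : Set} {P : Fin 5 → A → Set} (P? : ∀ i → Decidable (P i)) {m} →
  (∀ x → sum5 (λ i → indicator (P? i x)) ≤ m) →
  ∀ xs → sum5 (λ i → length (filter (P? i) xs)) ≤ m * length xs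
double-count P? few []                 = z≤n
double-count P? {m} few (x ∷ xs) = begin
  sum5 (λ i → length (filter (P? i) (x ∷ xs)))
    ≤⟨ sum5-mono (λ i → ≤-reflexive (length-filter-∷ (P? i) x xs)) ⟩
  sum5 (λ i → indicator (P? i x) + length (filter (P? i) xs))
    ≡⟨ sum5-+ (λ i → indicator (P? i x)) (λ i → length (filter (P? i) xs)) ⟩
  sum5 (λ i → indicator (P? i x)) + sum5 (λ i → length (filter (P? i) xs))
    ≤⟨ +-mono-≤ (few x) (double-count P? few xs) ⟩
  m + m * length xs
    ≡⟨ *-suc m (length xs) ⟨
  m * suc (length xs)
    ∎
  where open ≤-Reasoning

next5-moves : ∀ i → next5 i ≢ i
next5-moves zero                         ()
next5-moves (suc zero)                   ()
next5-moves (suc (suc zero))             ()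
next5-moves (suc (suc (suc zero)))       ()
next5-moves (suc (suc (suc (suc zero)))) ()

next-bag-adjacent : ∀ (H : Graph) {b} → IsPseudoBuoy H b → ∀ u v → b v ≡ next5 (b u) → Adj H u v
next-bag-adjacent H {b} buoy u v v∈next = proj₂ (buoy u v different) (inj₁ v∈next)
  where
  different : b u ≢ b v
  different bu≡bv = next5-moves (b u) (≡.trans (≡.sym v∈next) (≡.sym bu≡bv))

not-colourable : (h : ℕ) (H : Graph) (b : Fin (n H) → Fin 5) → IsPseudoBuoy H b →
  (k : Fin 5 → ℕ) → sum5 k > 2 * h →
  (∀ i → InducedChromaticNumber H (Bag H b i) (k i)) → ¬ Colorable H h
not-colourable h H b buoy k S>2h chromatic (colour , proper) = <⇒≱ S>2h (begin
  sum5 k                           ≤⟨ sum5-mono (λ i → chromatic-lower H (Bag H b i) (chromatic i)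
                                                                    (recolour i)) ⟩
  sum5 (λ i → length (used i))     ≤⟨ double-count usedOn? at-most-two-bags (allFin h) ⟩
  2 * length (allFin h)            ≡⟨ cong (2 *_) (length-tabulate {n = h} id) ⟩
  2 * h                            ∎)
  where
  open ≤-Reasoning
  UsedOn : Fin 5 → Fin h → Set
  UsedOn i c = ∃ λ v → b v ≡ i × colour v ≡ c
  usedOn? : ∀ i → Decidable (UsedOn i)
  usedOn? i c = any? (λ v → (b v ≟ᶠ i) ×-dec (colour v ≟ᶠ c))
  used : Fin 5 → List (Fin h)
  used i = filter (usedOn? i) (allFin h)
  recolour : ∀ i → InducedColorable H (Bag H b i) (length (used i))
  recolour i = recolour-into H (Bag H b i) (used i) ((λ v _ → colour v) , λ u v _ _ → proper u v)
                 (λ v v∈i → ∈-filter⁺ (usedOn? i) (∈-allFin (colour v)) (v , v∈i , refl))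
  not-consecutive : ∀ c i → indicator (usedOn? i c) + indicator (usedOn? (next5 i) c) ≤ 1
  not-consecutive c i with usedOn? i c | usedOn? (next5 i) c
  ... | yes (u , u∈i , cu) | yes (v , v∈next , cv) =
        ⊥-elim (proper u v (next-bag-adjacent H buoy u v (≡.trans v∈next (cong next5 (≡.sym u∈i))))
                           (≡.trans cu (≡.sym cv)))
  ... | yes _ | no _  = ≤-refl
  ... | no _  | yes _ = ≤-refl
  ... | no _  | no _  = z≤n
  at-most-two-bags : ∀ c → sum5 (λ i → indicator (usedOn? i c)) ≤ 2
  at-most-two-bags c = cycle-independence (λ i → indicator (usedOn? i c)) (not-consecutive c)

lemma10 : (h : ℕ) (H : Graph) (b : Fin (n H) → Fin 5) → IsPseudoBuoy H b →
    (k : Fin 5 → ℕ) →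
    (∀ i → InducedColorable H (Bag H b i) (k i)) →
    (∀ i → k i + k (next5 i) ≤ h) →
    ((sum5 k ≤ 2 * h → Colorable H h) ×
     (sum5 k > 2 * h → (∀ i → InducedChromaticNumber H (Bag H b i) (k i)) → ¬ Colorable H h))
lemma10 h H b buoy k bagColouring pairs = colourable , not-colourable h H b buoy k
  where
  colourable : sum5 k ≤ 2 * h → Colorable H h
  colourable S≤2h = colourable-from-palettes H b buoy k bagColouring
                      (palettes-from-gaps (gaps-exist h k pairs S≤2h))
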